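{- Autarky reduction on DQBFs is confluent: for every DQBF $F$ in prenex CNF, if $F$ can be transformed by a finite sequence of autarky-reduction steps into $G_1$ and also into $G_2$, then there is a DQBF $H$ such that both $G_1$ and $G_2$ can be transformed into $H$ by finite sequences of autarky-reduction steps.
   Context: A DQBF (dependency quantified Boolean formula) in CNF has the form $\forall x_1,\dots,x_n\,\exists y_1(D_1)\cdots\exists y_m(D_m): F_0$, where the $x_i$ are universal variables, the $y_j$ are existential variables, each dependency set $D_j\subseteq\{x_1,\dots,x_n\}$, and the matrix $F_0$ is a set of clauses over these variables. An autarky for $F$ is a partial assignment $\varphi$ to the existential variables which assigns to each variable $y_j$ in its domain a Boolean function of the universal variables in $D_j$, such that every clause of $F_0$ touched by $\varphi$ (i.e. containing a variable in the domain of $\varphi$) becomes a tautology after substituting the assigned functions for the assigned variables. For an autarky $\varphi$ of $F$, $F[\varphi]$ denotes the DQBF with the same prefix obtained by removing all clauses touched (hence satisfied) by $\varphi$. An autarky-reduction step transforms $F$ into $F[\varphi]$ for an autarky $\varphi$ of $F$. -}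

module Defs where

open import Data.Nat using (ℕ)
open import Data.Fin using (Fin)
open import Data.Fin.Subset using (Subset; _∈_)
open import Data.Bool using (Bool; true; false; not; _∨_; if_then_else_)
open import Data.Maybe using (Maybe; just; nothing; is-just)
open import Data.List using (List; filter)
open import Data.Bool.ListAction using (any)
open import Data.Product using (Σ; _×_)
open import Relation.Binary.PropositionalEquality using (_≡_)
open import Relation.Binary.Construct.Closure.ReflexiveTransitive using (Star)
open import Relation.Nullary.Decidable using (¬?)
open import Data.Bool.Properties using (T?)

data Var (n m : ℕ) : Set where
  univ  : Fin n → Var n m
  exist : Fin m → Var n m

-- A literal: a variable with a polarity (true = positive, false = negated).
record Literal (n m : ℕ) : Set where
  constructor lit
  field
    polarity : Bool
    var      : Var n m
open Literal public

Clause : ℕ → ℕ → Set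
Clause n m = List (Literal n m)

-- A DQBF  ∀x₁…xₙ ∃y₁(D₁)…∃yₘ(Dₘ) : F₀  in CNF.
record DQBF (n m : ℕ) : Set where
  constructor dqbf
  field
    deps   : Fin m → Subset n
    matrix : List (Clause n m)
open DQBF public

-- A Boolean function of the universal variables in D:
-- it receives values only for the universals belonging to D.
DepFun : {n : ℕ} → Subset n → Set
DepFun {n} D = ((i : Fin n) → i ∈ D → Bool) → Bool

-- A partial assignment of the existential variables of F:
-- y_j is either unassigned (nothing) or assigned a function of D_j.
PartialAssignment : {n m : ℕ} → DQBF n m → Set
PartialAssignment {n} {m} F = (j : Fin m) → Maybe (DepFun (deps F j))

module _ {n m : ℕ} (F : DQBF n m) (φ : PartialAssignment F) where

  assignedVar : Var n m → Bool
  assignedVar (univ i)  = false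
  assignedVar (exist j) = is-just (φ j)

  touched : Clause n m → Bool
  touched C = any (λ l → assignedVar (var l)) C

  -- value of a variable after substituting φ, under a total assignment
  -- a of the universals and e of the remaining existential variables
  valVar : (Fin n → Bool) → (Fin m → Bool) → Var n m → Bool
  valVar a e (univ i) = a i
  valVar a e (exist j) with φ j
  ... | just f  = f (λ i _ → a i)
  ... | nothing = e j

  valLit : (Fin n → Bool) → (Fin m → Bool) → Literal n m → Bool
  valLit a e (lit true v)  = valVar a e v
  valLit a e (lit false v) = not (valVar a e v)

  valClause : (Fin n → Bool) → (Fin m → Bool) → Clause n m → Bool
  valClause a e C = any (valLit a e) C

  Tautology : Clause n m → Set
  Tautology C = (a : Fin n → Bool) (e : Fin m → Bool) → valClause a e C ≡ true

data _∈ₗ_ {A : Set} (x : A) : List A → Set where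
  here  : ∀ {xs} → x ∈ₗ (x Data.List.∷ xs)
  there : ∀ {y xs} → x ∈ₗ xs → x ∈ₗ (y Data.List.∷ xs)

IsAutarky : {n m : ℕ} (F : DQBF n m) → PartialAssignment F → Set
IsAutarky F φ = ∀ C → C ∈ₗ matrix F → touched F φ C ≡ true → Tautology F φ C

reduce : {n m : ℕ} (F : DQBF n m) → PartialAssignment F → DQBF n m
reduce F φ = dqbf (deps F) (filter (λ C → ¬? (T? (touched F φ C))) (matrix F))

AutarkyStep : {n m : ℕ} → DQBF n m → DQBF n m → Set
AutarkyStep F G = Σ (PartialAssignment F) (λ φ → IsAutarky F φ × G ≡ reduce F φ)

_⟶*_ : {n m : ℕ} → DQBF n m → DQBF n m → Set
_⟶*_ = Star AutarkyStep

-- Two autarkies commute. Reducing by one autarky only deletes clauses, so the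
-- other remains an autarky of the smaller formula, and reducing by both, in
-- either order, deletes exactly the clauses touched by either of them. Hence a
-- single autarky-reduction step has the diamond property, and tiling diamonds
-- lifts it to confluence of finite sequences of steps.
module Submission where

open import Defs
open import Data.Nat using (ℕ)
open import Data.Bool using (true; false; not; _∨_; T)
open import Data.Bool.Properties using (T?)
open import Data.Maybe using (just; nothing)
open import Data.List using (List; []; _∷_; filter)
open import Data.List.Properties using (filter-≐)
open import Data.Product using (Σ; ∃; _×_; _,_)
open import Level using (Level; _⊔_)
open import Relation.Nullary using (does; ¬_; ¬?)
open import Relation.Unary using (Pred; Decidable)
open import Relation.Binary.Core using (Rel)
open import Relation.Binary.PropositionalEquality
  using (_≡_; refl; sym; trans; cong; cong₂; subst; module ≡-Reasoning)
open import Relation.Binary.Construct.Closure.ReflexiveTransitive using (Star; ε; _◅_)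
open import Relation.Binary.Rewriting using (Confluent)

module _ {a p q : Level} {A : Set a} {P : Pred A p} {Q : Pred A q}
         (P? : Decidable P) (Q? : Decidable Q) where

  filter-comm : ∀ xs → filter P? (filter Q? xs) ≡ filter Q? (filter P? xs)
  filter-comm [] = refl
  filter-comm (x ∷ xs) with does (P? x) in px | does (Q? x) in qx
  ... | true  | true  rewrite px | qx = cong (x ∷_) (filter-comm xs)
  ... | true  | false rewrite qx = filter-comm xs
  ... | false | true  rewrite px = filter-comm xs
  ... | false | false = filter-comm xs

module _ {A : Set} {P : Pred A Level.zero} (P? : Decidable P) where

  ∈ₗ-filter⁻ : ∀ xs {y} → y ∈ₗ filter P? xs → y ∈ₗ xs
  ∈ₗ-filter⁻ (x ∷ xs) y∈ with does (P? x)
  ∈ₗ-filter⁻ (x ∷ xs) here        | true = here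
  ∈ₗ-filter⁻ (x ∷ xs) (there y∈) | true = there (∈ₗ-filter⁻ xs y∈)
  ... | false = there (∈ₗ-filter⁻ xs y∈)

module _ {a ℓ : Level} {A : Set a} (_⟶_ : Rel A ℓ) where

  Diamond : Set (a ⊔ ℓ)
  Diamond = ∀ {x y z} → x ⟶ y → x ⟶ z → ∃ λ w → (y ⟶ w) × (z ⟶ w)

  diamond-strip : Diamond → ∀ {x y z} → x ⟶ y → Star _⟶_ x z →
                  ∃ λ w → Star _⟶_ y w × (z ⟶ w)
  diamond-strip ◇ x⟶y ε = _ , ε , x⟶y
  diamond-strip ◇ x⟶y (x⟶u ◅ u⟶*z) with ◇ x⟶y x⟶u
  ... | v , y⟶v , u⟶v with diamond-strip ◇ u⟶v u⟶*z
  ...   | w , v⟶*w , z⟶w = w , y⟶v ◅ v⟶*w , z⟶w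

  diamond⇒confluent : Diamond → Confluent _⟶_
  diamond⇒confluent ◇ ε x⟶*z = _ , x⟶*z , ε
  diamond⇒confluent ◇ (x⟶u ◅ u⟶*y) x⟶*z with diamond-strip ◇ x⟶u x⟶*z
  ... | v , u⟶*v , z⟶v with diamond⇒confluent ◇ u⟶*y u⟶*v
  ...   | w , y⟶*w , v⟶*w = w , y⟶*w , z⟶v ◅ v⟶*w

withMatrix : {n m : ℕ} → DQBF n m → List (Clause n m) → DQBF n m
withMatrix F M = dqbf (deps F) M

module _ {n m : ℕ} (F : DQBF n m) (M : List (Clause n m)) (φ : PartialAssignment F) where

  private
    F′ : DQBF n m
    F′ = withMatrix F M

  assignedVar-withMatrix : ∀ v → assignedVar F′ φ v ≡ assignedVar F φ v
  assignedVar-withMatrix (univ i)  = refl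
  assignedVar-withMatrix (exist j) = refl

  touched-withMatrix : ∀ C → touched F′ φ C ≡ touched F φ C
  touched-withMatrix []      = refl
  touched-withMatrix (l ∷ C) = cong₂ _∨_ (assignedVar-withMatrix (var l)) (touched-withMatrix C)

  valVar-withMatrix : ∀ a e v → valVar F′ φ a e v ≡ valVar F φ a e v
  valVar-withMatrix a e (univ i) = refl
  valVar-withMatrix a e (exist j) with φ j
  ... | just f  = refl
  ... | nothing = refl

  valLit-withMatrix : ∀ a e l → valLit F′ φ a e l ≡ valLit F φ a e l
  valLit-withMatrix a e (lit true v)  = valVar-withMatrix a e v
  valLit-withMatrix a e (lit false v) = cong not (valVar-withMatrix a e v)

  valClause-withMatrix : ∀ a e C → valClause F′ φ a e C ≡ valClause F φ a e C
  valClause-withMatrix a e []      = refl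
  valClause-withMatrix a e (l ∷ C) =
    cong₂ _∨_ (valLit-withMatrix a e l) (valClause-withMatrix a e C)

  IsAutarky-⊆ : IsAutarky F φ → (∀ {C} → C ∈ₗ M → C ∈ₗ matrix F) → IsAutarky F′ φ
  IsAutarky-⊆ aut M⊆F C C∈M touches a e =
    trans (valClause-withMatrix a e C)
          (aut C (M⊆F C∈M) (trans (sym (touched-withMatrix C)) touches) a e)

untouched? : {n m : ℕ} (F : DQBF n m) (φ : PartialAssignment F) →
             Decidable (λ C → ¬ T (touched F φ C))
untouched? F φ C = ¬? (T? (touched F φ C))

module _ {n m : ℕ} (F : DQBF n m) where

  filter-untouched-withMatrix : ∀ M (φ : PartialAssignment F) →
    filter (untouched? (withMatrix F M) φ) M ≡ filter (untouched? F φ) M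
  filter-untouched-withMatrix M φ =
    filter-≐ (untouched? (withMatrix F M) φ) (untouched? F φ)
      ( (λ {C} ¬t t → ¬t (subst T (sym (touched-withMatrix F M φ C)) t))
      , (λ {C} ¬t t → ¬t (subst T (touched-withMatrix F M φ C) t)) )
      M

  reduce-comm : (φ₁ φ₂ : PartialAssignment F) →
                reduce (reduce F φ₁) φ₂ ≡ reduce (reduce F φ₂) φ₁
  reduce-comm φ₁ φ₂ = cong (withMatrix F) (begin
    filter (untouched? (reduce F φ₁) φ₂) M₁  ≡⟨ filter-untouched-withMatrix M₁ φ₂ ⟩
    filter (untouched? F φ₂) M₁              ≡⟨ filter-comm (untouched? F φ₂) (untouched? F φ₁) (matrix F) ⟩
    filter (untouched? F φ₁) M₂              ≡⟨ sym (filter-untouched-withMatrix M₂ φ₁) ⟩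
    filter (untouched? (reduce F φ₂) φ₁) M₂  ∎)
    where
    open ≡-Reasoning
    M₁ M₂ : List (Clause n m)
    M₁ = matrix (reduce F φ₁)
    M₂ = matrix (reduce F φ₂)

  IsAutarky-reduce : ∀ {φ} ψ → IsAutarky F φ → IsAutarky (reduce F ψ) φ
  IsAutarky-reduce ψ aut = IsAutarky-⊆ F _ _ aut (∈ₗ-filter⁻ (untouched? F ψ) (matrix F))

autarkyStep-diamond : {n m : ℕ} → Diamond (AutarkyStep {n} {m})
autarkyStep-diamond {x = F} (φ₁ , aut₁ , refl) (φ₂ , aut₂ , refl) =
  reduce (reduce F φ₁) φ₂ ,
  (φ₂ , IsAutarky-reduce F φ₁ aut₂ , refl) ,
  (φ₁ , IsAutarky-reduce F φ₂ aut₁ , reduce-comm F φ₁ φ₂)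

lemma2 : {n m : ℕ} (F G₁ G₂ : DQBF n m) → F ⟶* G₁ → F ⟶* G₂ →
    Σ (DQBF n m) (λ H → (G₁ ⟶* H) × (G₂ ⟶* H))
lemma2 F G₁ G₂ = diamond⇒confluent AutarkyStep autarkyStep-diamond
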